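{- Let $n$ be a positive integer and let $b<\binom{n}{2}$ be a positive integer. Let $x_px_q$ be the $b$-th largest monomial in the lexicographic order among the squarefree degree $2$ monomials in the variables $x_1,\ldots,x_n$, with $p<q$. Then $$p=n-1-\left\lfloor-\frac{1}{2}+\frac{\sqrt{4n(n-1)-8b+1}}{2}\right\rfloor\quad\text{and}\quad q=b+\binom{p+1}{2}-(p-1)n.$$
   Context: The lexicographic order on monomials has $x_1>x_2>\dots>x_n$: $x^a>x^b$ if the leftmost nonzero entry of $a-b$ is positive. -}

module Defs where

open import Data.Bool using (Bool; true; false; if_then_else_)
open import Data.Nat as ℕ using (ℕ; zero; suc; _<ᵇ_; _≡ᵇ_)
open import Data.Integer as ℤ using (ℤ; +_; _≤_; _<_)
open import Data.List using (List; []; _∷_; map; upTo; concatMap; filterᵇ; length)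
open import Data.Product using (_×_; _,_)
open import Data.Sum using (_⊎_)

idx : ℕ → List ℕ
idx n = map suc (upTo n)

ind : Bool → ℕ
ind true = 1
ind false = 0

-- exponent vector (a_1,...,a_n) of the monomial x_p x_q in variables x_1..x_n
expo : ℕ → ℕ → ℕ → List ℕ
expo n p q = map (λ k → ind (k ≡ᵇ p) ℕ.+ ind (k ≡ᵇ q)) (idx n)

-- lexicographic order with x_1 > x_2 > ... > x_n :
-- x^a > x^b iff the leftmost nonzero entry of a - b is positive
lexGt : List ℕ → List ℕ → Bool
lexGt [] _ = false
lexGt (_ ∷ _) [] = false
lexGt (a ∷ as) (b ∷ bs) =
  if b <ᵇ a then true else (if a <ᵇ b then false else lexGt as bs)

-- the squarefree degree-2 monomials x_i x_j (1 ≤ i < j ≤ n), as index pairs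
sqfree2 : ℕ → List (ℕ × ℕ)
sqfree2 n = concatMap (λ i → map (λ j → (i , j)) (filterᵇ (λ j → i <ᵇ j) (idx n))) (idx n)

numLarger : ℕ → ℕ → ℕ → ℕ
numLarger n p q =
  length (filterᵇ (λ { (i , j) → lexGt (expo n i j) (expo n p q) }) (sqfree2 n))

-- m = ⌊ -1/2 + √D / 2 ⌋  (for D ≥ 0), i.e. m ≤ -1/2 + √D/2 < m + 1,
-- i.e. 2m+1 ≤ √D < 2m+3, written out without real numbers.
IsFloorHalfSqrt : ℤ → ℤ → Set
IsFloorHalfSqrt D m =
  ((ℤ.+ 2 ℤ.* m ℤ.+ ℤ.+ 1 ≤ ℤ.0ℤ)
     ⊎ ((ℤ.+ 2 ℤ.* m ℤ.+ ℤ.+ 1) ℤ.* (ℤ.+ 2 ℤ.* m ℤ.+ ℤ.+ 1) ≤ D))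
  × (ℤ.0ℤ < ℤ.+ 2 ℤ.* m ℤ.+ ℤ.+ 3)
  × (D < (ℤ.+ 2 ℤ.* m ℤ.+ ℤ.+ 3) ℤ.* (ℤ.+ 2 ℤ.* m ℤ.+ ℤ.+ 3))

module Submission where

-- Write p = p' + 1, q = p + 1 + r and n = q + s.
--
-- The exponent vectors of x_i x_j and x_p x_q agree before the
--   first index among i, j, p, q where they differ, so x_i x_j > x_p x_q
--   exactly when (i, j) precedes (p, q) lexicographically as an index pair.
-- * RowCount (using the list counting of Counting).  Counting the preceding
--   pairs i < j row by row, a row i < p contributes n - i pairs, row p the r
--   pairs p < j < q, and later rows nothing: b - 1 = Σ_{i<p} (n - i) + r.
-- * Arithmetic.  With Σ_{i<p} (n - i) = (p-1) n - C(p, 2) this becomes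
--   b + C(p+1, 2) = q + (p-1) n, and 4n(n-1) + 1 = (2k+1)^2 + 8s + 8b for
--   k = r + s = n - 1 - p; as s ≤ k the discriminant 4n(n-1) - 8b + 1 lies
--   in [(2k+1)^2, (2k+3)^2).
-- * FloorHalfSqrt.  The floor ⌊-1/2 + √D/2⌋ is the unique m with
--   (2m+1)^2 ≤ D < (2m+3)^2, hence equal to k.
-- * IntegerForms moves the natural-number identities to the integer
--   expressions of the statement, and lemma5p3 combines the pieces.

open import Defs

module Counting where

  open import Data.Bool using (Bool; true; false; _∧_)
  open import Data.Nat using (ℕ; zero; suc; _+_; _≤_; _<_; z<s)
  open import Data.Nat.Properties using (≤-refl; <⇒≤; +-suc; +-identityʳ; m<m+n)
  open import Data.Nat.ListAction using (sum)
  open import Data.List using (List; []; _∷_; _++_; map; concatMap; filterᵇ; length; applyUpTo)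
  open import Data.List.Relation.Unary.All using (All; []; _∷_)
  open import Relation.Binary.PropositionalEquality

  count : {A : Set} → (A → Bool) → List A → ℕ
  count p xs = length (filterᵇ p xs)

  count-++ : {A : Set} (p : A → Bool) (xs ys : List A) → count p (xs ++ ys) ≡ count p xs + count p ys
  count-++ p [] ys = refl
  count-++ p (x ∷ xs) ys with p x
  ... | true = cong suc (count-++ p xs ys)
  ... | false = count-++ p xs ys

  count-concatMap : {A B : Set} (p : B → Bool) (f : A → List B) (xs : List A)
    → count p (concatMap f xs) ≡ sum (map (λ x → count p (f x)) xs)
  count-concatMap p f [] = refl
  count-concatMap p f (x ∷ xs) =
    trans (count-++ p (f x) (concatMap f xs)) (cong (count p (f x) +_) (count-concatMap p f xs))

  count-map-filter : {A B : Set} (p : B → Bool) (q : A → Bool) (g : A → B) (xs : List A)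
    → count p (map g (filterᵇ q xs)) ≡ count (λ x → q x ∧ p (g x)) xs
  count-map-filter p q g [] = refl
  count-map-filter p q g (x ∷ xs) with q x
  ... | false = count-map-filter p q g xs
  ... | true with p (g x)
  ...   | true = cong suc (count-map-filter p q g xs)
  ...   | false = count-map-filter p q g xs

  count-cong : {A : Set} {p q : A → Bool} {xs : List A} → All (λ x → p x ≡ q x) xs → count p xs ≡ count q xs
  count-cong [] = refl
  count-cong {p = p} {q} {x ∷ _} (px≡qx ∷ rest) with p x | q x | px≡qx
  ... | true | true | _ = cong suc (count-cong rest)
  ... | false | false | _ = count-cong rest
  ... | true | false | ()
  ... | false | true | ()

  count-all : {A : Set} {p : A → Bool} {xs : List A} → All (λ x → p x ≡ true) xs → count p xs ≡ length xs
  count-all [] = refl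
  count-all {p = p} {x ∷ _} (px ∷ rest) rewrite px = cong suc (count-all rest)

  count-none : {A : Set} {p : A → Bool} {xs : List A} → All (λ x → p x ≡ false) xs → count p xs ≡ 0
  count-none [] = refl
  count-none {p = p} {x ∷ _} (px ∷ rest) rewrite px = count-none rest

  sum-zeros : {A : Set} {f : A → ℕ} {xs : List A} → All (λ x → f x ≡ 0) xs → sum (map f xs) ≡ 0
  sum-zeros [] = refl
  sum-zeros (fx ∷ rest) = cong₂ _+_ fx (sum-zeros rest)

  interval : ℕ → ℕ → List ℕ
  interval s zero = []
  interval s (suc l) = s ∷ interval (suc s) l

  length-interval : ∀ s l → length (interval s l) ≡ l
  length-interval s zero = refl
  length-interval s (suc l) = cong suc (length-interval (suc s) l)

  interval-++ : ∀ s a b → interval s (a + b) ≡ interval s a ++ interval (s + a) b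
  interval-++ s zero b = cong (λ t → interval t b) (sym (+-identityʳ s))
  interval-++ s (suc a) b =
    cong (s ∷_) (trans (interval-++ (suc s) a b) (cong (λ t → interval (suc s) a ++ interval t b) (sym (+-suc s a))))

  all-interval : ∀ {P : ℕ → Set} s l → (∀ k → s ≤ k → k < s + l → P k) → All P (interval s l)
  all-interval s zero h = []
  all-interval s (suc l) h =
    h s ≤-refl (m<m+n s z<s)
    ∷ all-interval (suc s) l (λ k s<k k<end → h k (<⇒≤ s<k) (subst (k <_) (sym (+-suc s l)) k<end))

  idx-interval : ∀ n → idx n ≡ interval 1 n
  idx-interval n = shifted n 0 (λ k → k) (λ k → refl)
    where
    shifted : ∀ l s (f : ℕ → ℕ) → (∀ k → f k ≡ s + k) → map suc (applyUpTo f l) ≡ interval (suc s) l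
    shifted zero s f hf = refl
    shifted (suc l) s f hf =
      cong₂ _∷_ (cong suc (trans (hf 0) (+-identityʳ s)))
        (shifted l (suc s) (λ k → f (suc k)) (λ k → trans (hf (suc k)) (+-suc s k)))

  count-window : ∀ (p : ℕ → Bool) a x y
    → All (λ k → p k ≡ false) (interval 1 a)
    → All (λ k → p k ≡ true) (interval (suc a) x)
    → All (λ k → p k ≡ false) (interval (suc a + x) y)
    → count p (interval 1 (a + (x + y))) ≡ x
  count-window p a x y before inside after =
    begin
      count p (interval 1 (a + (x + y)))
    ≡⟨ cong (count p) (interval-++ 1 a (x + y)) ⟩
      count p (interval 1 a ++ interval (suc a) (x + y))
    ≡⟨ count-++ p (interval 1 a) _ ⟩
      count p (interval 1 a) + count p (interval (suc a) (x + y))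
    ≡⟨ cong₂ _+_ (count-none before) (cong (count p) (interval-++ (suc a) x y)) ⟩
      count p (interval (suc a) x ++ interval (suc a + x) y)
    ≡⟨ count-++ p (interval (suc a) x) _ ⟩
      count p (interval (suc a) x) + count p (interval (suc a + x) y)
    ≡⟨ cong₂ _+_ (trans (count-all inside) (length-interval (suc a) x)) (count-none after) ⟩
      x + 0
    ≡⟨ +-identityʳ x ⟩
      x
    ∎
    where
    open ≡-Reasoning

module LexOrder where

  open Counting using (interval; interval-++; all-interval; idx-interval)
  open import Data.Bool using (Bool; true; false; _∧_; _∨_)
  open import Data.Nat using (ℕ; zero; suc; pred; _+_; _≤_; _<_; _<ᵇ_; _≡ᵇ_; s≤s; z≤n)
  open import Data.Nat.Properties
    using (≤-trans; <-trans; <⇒≤; <⇒≢; >⇒≢; <-asym; <-cmp; +-suc; m≤n⇒∃[o]m+o≡n; <ᵇ-reflects-<; ≡ᵇ⇒≡; ≡⇒≡ᵇ)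
  open import Data.List using (List; []; _∷_; _++_; map)
  open import Data.List.Properties using (map-++; map-cong-local)
  open import Data.Product using (Σ; ∃₂; _,_)
  open import Relation.Nullary using (¬_)
  open import Relation.Nullary.Reflects using (ofʸ; ofⁿ; det; fromEquivalence)
  open import Relation.Binary.Definitions using (tri<; tri≈; tri>)
  open import Relation.Binary.PropositionalEquality

  <ᵇ-true : ∀ {m n} → m < n → (m <ᵇ n) ≡ true
  <ᵇ-true {m} {n} m<n = det (<ᵇ-reflects-< m n) (ofʸ m<n)

  <ᵇ-false : ∀ {m n} → ¬ m < n → (m <ᵇ n) ≡ false
  <ᵇ-false {m} {n} m≮n = det (<ᵇ-reflects-< m n) (ofⁿ m≮n)

  ≡ᵇ-true : ∀ {m n} → m ≡ n → (m ≡ᵇ n) ≡ true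
  ≡ᵇ-true {m} {n} m≡n = det (fromEquivalence (≡ᵇ⇒≡ m n) (≡⇒≡ᵇ m n)) (ofʸ m≡n)

  ≡ᵇ-false : ∀ {m n} → m ≢ n → (m ≡ᵇ n) ≡ false
  ≡ᵇ-false {m} {n} m≢n = det (fromEquivalence (≡ᵇ⇒≡ m n) (≡⇒≡ᵇ m n)) (ofⁿ m≢n)

  <ᵇ-irrefl : ∀ m → (m <ᵇ m) ≡ false
  <ᵇ-irrefl zero = refl
  <ᵇ-irrefl (suc m) = <ᵇ-irrefl m

  lexGt-irrefl : ∀ xs → lexGt xs xs ≡ false
  lexGt-irrefl [] = refl
  lexGt-irrefl (x ∷ xs) rewrite <ᵇ-irrefl x = lexGt-irrefl xs

  lexGt-prefix : ∀ us xs ys → lexGt (us ++ xs) (us ++ ys) ≡ lexGt xs ys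
  lexGt-prefix [] xs ys = refl
  lexGt-prefix (u ∷ us) xs ys rewrite <ᵇ-irrefl u = lexGt-prefix us xs ys

  interval-split : ∀ {t n} → 1 ≤ t → t ≤ n → Σ (List ℕ) λ rest → interval 1 n ≡ interval 1 (pred t) ++ t ∷ rest
  interval-split {suc t'} {n} (s≤s z≤n) t≤n with o , t+o≡n ← m≤n⇒∃[o]m+o≡n t≤n =
    interval (suc (suc t')) o ,
    trans (cong (interval 1) (trans (sym t+o≡n) (sym (+-suc t' o)))) (interval-++ 1 t' (suc o))

  lexGt-decidedAt : ∀ (f g : ℕ → ℕ) {n t} → 1 ≤ t → t ≤ n → (∀ k → k < t → f k ≡ g k)
    → ∃₂ λ fs gs → lexGt (map f (interval 1 n)) (map g (interval 1 n)) ≡ lexGt (f t ∷ fs) (g t ∷ gs)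
  lexGt-decidedAt f g {n} {t@(suc t')} 1≤t t≤n agree with rest , split ← interval-split 1≤t t≤n =
    map f rest , map g rest ,
    (begin
      lexGt (map f (interval 1 n)) (map g (interval 1 n))
    ≡⟨ cong₂ lexGt (cong (map f) split) (cong (map g) split) ⟩
      lexGt (map f (interval 1 (pred t) ++ t ∷ rest)) (map g (interval 1 (pred t) ++ t ∷ rest))
    ≡⟨ cong₂ lexGt (map-++ f (interval 1 (pred t)) _) (map-++ g (interval 1 (pred t)) _) ⟩
      lexGt (map f (interval 1 (pred t)) ++ f t ∷ map f rest) (map g (interval 1 (pred t)) ++ g t ∷ map g rest)
    ≡⟨ cong (λ us → lexGt (us ++ f t ∷ map f rest) (map g (interval 1 (pred t)) ++ g t ∷ map g rest)) agreeBefore ⟩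
      lexGt (map g (interval 1 (pred t)) ++ f t ∷ map f rest) (map g (interval 1 (pred t)) ++ g t ∷ map g rest)
    ≡⟨ lexGt-prefix (map g (interval 1 (pred t))) _ _ ⟩
      lexGt (f t ∷ map f rest) (g t ∷ map g rest)
    ∎)
    where
    open ≡-Reasoning
    agreeBefore : map f (interval 1 (pred t)) ≡ map g (interval 1 (pred t))
    agreeBefore = map-cong-local (all-interval 1 t' (λ k _ k<t → agree k k<t))

  lexGt-wins : ∀ (f g : ℕ → ℕ) {n t} → 1 ≤ t → t ≤ n → (∀ k → k < t → f k ≡ g k)
    → f t ≡ 1 → g t ≡ 0 → lexGt (map f (interval 1 n)) (map g (interval 1 n)) ≡ true
  lexGt-wins f g 1≤t t≤n agree ft gt with fs , gs , decided ← lexGt-decidedAt f g 1≤t t≤n agree =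
    trans decided (cong₂ (λ a b → lexGt (a ∷ fs) (b ∷ gs)) ft gt)

  lexGt-loses : ∀ (f g : ℕ → ℕ) {n t} → 1 ≤ t → t ≤ n → (∀ k → k < t → f k ≡ g k)
    → f t ≡ 0 → g t ≡ 1 → lexGt (map f (interval 1 n)) (map g (interval 1 n)) ≡ false
  lexGt-loses f g 1≤t t≤n agree ft gt with fs , gs , decided ← lexGt-decidedAt f g 1≤t t≤n agree =
    trans decided (cong₂ (λ a b → lexGt (a ∷ fs) (b ∷ gs)) ft gt)

  mult : ℕ → ℕ → ℕ → ℕ
  mult i j k = ind (k ≡ᵇ i) + ind (k ≡ᵇ j)

  expo-interval : ∀ n i j → expo n i j ≡ map (mult i j) (interval 1 n)
  expo-interval n i j = cong (map (mult i j)) (idx-interval n)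

  mult-off : ∀ {i j k} → k ≢ i → k ≢ j → mult i j k ≡ 0
  mult-off k≢i k≢j rewrite ≡ᵇ-false k≢i | ≡ᵇ-false k≢j = refl

  mult-below : ∀ {i j k} → k < i → i < j → mult i j k ≡ 0
  mult-below k<i i<j = mult-off (<⇒≢ k<i) (<⇒≢ (<-trans k<i i<j))

  mult-first : ∀ {i j} → i < j → mult i j i ≡ 1
  mult-first {i} i<j rewrite ≡ᵇ-true (refl {x = i}) | ≡ᵇ-false (<⇒≢ i<j) = refl

  mult-second : ∀ {i j} → i < j → mult i j j ≡ 1
  mult-second {i} {j} i<j rewrite ≡ᵇ-false (>⇒≢ i<j) | ≡ᵇ-true (refl {x = j}) = refl

  mult-agree : ∀ {i j q k} → k ≢ j → k ≢ q → mult i j k ≡ mult i q k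
  mult-agree k≢j k≢q rewrite ≡ᵇ-false k≢j | ≡ᵇ-false k≢q = refl

  pairBefore : ℕ → ℕ → ℕ → ℕ → Bool
  pairBefore p q i j = (i <ᵇ p) ∨ ((i ≡ᵇ p) ∧ (j <ᵇ q))

  lexGt-monomials : ∀ {n i j p q} → 1 ≤ i → i < j → j ≤ n → 1 ≤ p → p < q → q ≤ n
    → lexGt (expo n i j) (expo n p q) ≡ pairBefore p q i j
  lexGt-monomials {n} {i} {j} {p} {q} 1≤i i<j j≤n 1≤p p<q q≤n
    rewrite expo-interval n i j | expo-interval n p q with <-cmp i p
  ... | tri< i<p _ _ rewrite <ᵇ-true i<p =
    lexGt-wins (mult i j) (mult p q) 1≤i (≤-trans (<⇒≤ i<j) j≤n)
      (λ k k<i → trans (mult-below k<i i<j) (sym (mult-below (<-trans k<i i<p) p<q)))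
      (mult-first i<j) (mult-below i<p p<q)
  ... | tri> _ _ p<i rewrite <ᵇ-false (<-asym p<i) | ≡ᵇ-false (>⇒≢ p<i) =
    lexGt-loses (mult i j) (mult p q) 1≤p (≤-trans (<⇒≤ p<q) q≤n)
      (λ k k<p → trans (mult-below (<-trans k<p p<i) i<j) (sym (mult-below k<p p<q)))
      (mult-below p<i i<j) (mult-first p<q)
  ... | tri≈ _ refl _ rewrite <ᵇ-irrefl i | ≡ᵇ-true (refl {x = i}) with <-cmp j q
  ...   | tri< j<q _ _ rewrite <ᵇ-true j<q =
    lexGt-wins (mult i j) (mult i q) (≤-trans 1≤i (<⇒≤ i<j)) j≤n
      (λ k k<j → mult-agree (<⇒≢ k<j) (<⇒≢ (<-trans k<j j<q)))
      (mult-second i<j) (mult-off (>⇒≢ i<j) (<⇒≢ j<q))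
  ...   | tri> _ _ q<j rewrite <ᵇ-false (<-asym q<j) =
    lexGt-loses (mult i j) (mult i q) (≤-trans 1≤i (<⇒≤ p<q)) q≤n
      (λ k k<q → mult-agree (<⇒≢ (<-trans k<q q<j)) (<⇒≢ k<q))
      (mult-off (>⇒≢ p<q) (<⇒≢ q<j)) (mult-second p<q)
  ...   | tri≈ _ refl _ rewrite <ᵇ-irrefl j = lexGt-irrefl (map (mult i j) (interval 1 n))

module RowCount where

  open Counting
  open LexOrder using (pairBefore; lexGt-monomials; <ᵇ-true; <ᵇ-false; ≡ᵇ-true; ≡ᵇ-false; <ᵇ-irrefl)
  open import Data.Bool using (Bool; true; false; _∧_)
  open import Data.Bool.Properties using (∧-identityʳ; ∧-zeroʳ)
  open import Data.Nat using (ℕ; suc; _+_; _∸_; _≤_; _<_; _<ᵇ_; s≤s; z≤n; s≤s⁻¹; _<?_)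
  open import Data.Nat.Properties
    using (≤-trans; <⇒≤; ≤⇒≯; <-asym; >⇒≢; m≤m+n; m+[n∸m]≡n; +-identityʳ; +-suc; +-assoc; n≤1+n)
  open import Data.Product using (_,_)
  open import Data.Nat.ListAction using (sum)
  open import Data.Nat.ListAction.Properties using (sum-++)
  open import Data.List using (_∷_; _++_; map; filterᵇ)
  open import Data.List.Properties using (map-cong; map-cong-local; map-++)
  open import Data.List.Relation.Unary.All using ([])
  open import Relation.Nullary using (yes; no)
  open import Relation.Binary.PropositionalEquality

  row : ℕ → ℕ → ℕ → ℕ → ℕ
  row n p q i = count (λ j → (i <ᵇ j) ∧ pairBefore p q i j) (interval 1 n)

  numLarger-rows : ∀ {n p q} → 1 ≤ p → p < q → q ≤ n → numLarger n p q ≡ sum (map (row n p q) (interval 1 n))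
  numLarger-rows {n} {p} {q} 1≤p p<q q≤n =
    begin
      numLarger n p q
    ≡⟨ count-concatMap _ _ (idx n) ⟩
      sum (map (λ i → count _ (map (i ,_) (filterᵇ (i <ᵇ_) (idx n)))) (idx n))
    ≡⟨ cong sum (map-cong (λ i → count-map-filter _ (i <ᵇ_) (i ,_) (idx n)) (idx n)) ⟩
      sum (map (λ i → count (larger i) (idx n)) (idx n))
    ≡⟨ cong (λ is → sum (map (λ i → count (larger i) is) is)) (idx-interval n) ⟩
      sum (map (λ i → count (larger i) (interval 1 n)) (interval 1 n))
    ≡⟨ cong sum (map-cong-local (all-interval 1 n λ i 1≤i i<1+n →
         count-cong (all-interval 1 n λ j _ j<1+n → larger-before i j 1≤i (s≤s⁻¹ j<1+n)))) ⟩
      sum (map (row n p q) (interval 1 n))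
    ∎
    where
    open ≡-Reasoning
    larger : ℕ → ℕ → Bool
    larger i j = (i <ᵇ j) ∧ lexGt (expo n i j) (expo n p q)
    larger-before : ∀ i j → 1 ≤ i → j ≤ n → larger i j ≡ ((i <ᵇ j) ∧ pairBefore p q i j)
    larger-before i j 1≤i j≤n with i <? j
    ... | yes i<j rewrite <ᵇ-true i<j = lexGt-monomials 1≤i i<j j≤n 1≤p p<q q≤n
    ... | no i≮j rewrite <ᵇ-false i≮j = refl

  row-before : ∀ {n p q i} → i < p → i ≤ n → row n p q i ≡ n ∸ i
  row-before {n} {p} {q} {i} i<p i≤n =
    begin
      row n p q i
    ≡⟨ count-cong (all-interval 1 n λ j _ _ → trans (cong ((i <ᵇ j) ∧_) rowIsBefore) (∧-identityʳ _)) ⟩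
      count (i <ᵇ_) (interval 1 n)
    ≡⟨ cong (λ l → count (i <ᵇ_) (interval 1 l)) n≡i+[n∸i] ⟩
      count (i <ᵇ_) (interval 1 (i + ((n ∸ i) + 0)))
    ≡⟨ count-window (i <ᵇ_) i (n ∸ i) 0
         (all-interval 1 i λ k _ k<1+i → <ᵇ-false (≤⇒≯ (s≤s⁻¹ k<1+i)))
         (all-interval (suc i) (n ∸ i) λ k i<k _ → <ᵇ-true i<k)
         [] ⟩
      n ∸ i
    ∎
    where
    open ≡-Reasoning
    rowIsBefore : ∀ {j} → pairBefore p q i j ≡ true
    rowIsBefore rewrite <ᵇ-true i<p = refl
    n≡i+[n∸i] : n ≡ i + ((n ∸ i) + 0)
    n≡i+[n∸i] = sym (trans (cong (i +_) (+-identityʳ (n ∸ i))) (m+[n∸m]≡n i≤n))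

  row-at : ∀ p r s → row (suc (p + r) + s) p (suc (p + r)) p ≡ r
  row-at p r s =
    begin
      row n p q p
    ≡⟨ count-cong (all-interval 1 n λ j _ _ → cong ((p <ᵇ j) ∧_) (rowIsBetween {j})) ⟩
      count between (interval 1 n)
    ≡⟨ cong (λ l → count between (interval 1 l)) n≡p+[r+1+s] ⟩
      count between (interval 1 (p + (r + suc s)))
    ≡⟨ count-window between p r (suc s)
         (all-interval 1 p λ k _ k<1+p → cong (_∧ (k <ᵇ q)) (<ᵇ-false (≤⇒≯ (s≤s⁻¹ k<1+p))))
         (all-interval (suc p) r λ k p<k k<q → cong₂ _∧_ (<ᵇ-true p<k) (<ᵇ-true k<q))
         (all-interval q (suc s) λ k q≤k _ →
           cong₂ _∧_ (<ᵇ-true (≤-trans (s≤s (m≤m+n p r)) q≤k)) (<ᵇ-false (≤⇒≯ q≤k))) ⟩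
      r
    ∎
    where
    open ≡-Reasoning
    q n : ℕ
    q = suc (p + r)
    n = q + s
    between : ℕ → Bool
    between j = (p <ᵇ j) ∧ (j <ᵇ q)
    rowIsBetween : ∀ {j} → pairBefore p q p j ≡ (j <ᵇ q)
    rowIsBetween rewrite <ᵇ-irrefl p | ≡ᵇ-true (refl {x = p}) = refl
    n≡p+[r+1+s] : n ≡ p + (r + suc s)
    n≡p+[r+1+s] = trans (sym (+-suc (p + r) s)) (+-assoc p r (suc s))

  row-after : ∀ {n p q i} → p < i → row n p q i ≡ 0
  row-after {n} {p} {q} {i} p<i =
    count-none (all-interval 1 n λ j _ _ → trans (cong ((i <ᵇ j) ∧_) rowIsAfter) (∧-zeroʳ _))
    where
    rowIsAfter : ∀ {j} → pairBefore p q i j ≡ false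
    rowIsAfter rewrite <ᵇ-false (<-asym p<i) | ≡ᵇ-false (>⇒≢ p<i) = refl

  rowSum : ℕ → ℕ → ℕ
  rowSum n t = sum (map (n ∸_) (interval 1 t))

  numLarger-formula : ∀ p' r s → let p = suc p' ; q = suc (p + r) ; n = q + s in
    numLarger n p q ≡ rowSum n p' + r
  numLarger-formula p' r s =
    begin
      numLarger n p q
    ≡⟨ numLarger-rows (s≤s z≤n) (s≤s (m≤m+n p r)) (m≤m+n q s) ⟩
      sum (map (row n p q) (interval 1 n))
    ≡⟨ cong (λ l → sum (map (row n p q) (interval 1 l))) n≡p'+[1+later] ⟩
      sum (map (row n p q) (interval 1 (p' + suc later)))
    ≡⟨ cong (λ is → sum (map (row n p q) is)) (interval-++ 1 p' (suc later)) ⟩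
      sum (map (row n p q) (interval 1 p' ++ p ∷ interval (suc p) later))
    ≡⟨ cong sum (map-++ (row n p q) (interval 1 p') _) ⟩
      sum (map (row n p q) (interval 1 p') ++ row n p q p ∷ map (row n p q) (interval (suc p) later))
    ≡⟨ sum-++ (map (row n p q) (interval 1 p')) _ ⟩
      sum (map (row n p q) (interval 1 p')) + (row n p q p + sum (map (row n p q) (interval (suc p) later)))
    ≡⟨ cong₂ _+_
         (cong sum (map-cong-local (all-interval 1 p' λ i _ i<p → row-before {n} {p} {q} i<p (≤-trans (<⇒≤ i<p) p≤n))))
         (cong₂ _+_ (row-at p r s) (sum-zeros (all-interval (suc p) later λ i p<i _ → row-after {n} {p} {q} p<i))) ⟩
      rowSum n p' + (r + 0)
    ≡⟨ cong (rowSum n p' +_) (+-identityʳ r) ⟩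
      rowSum n p' + r
    ∎
    where
    open ≡-Reasoning
    p q n later : ℕ
    p = suc p'
    q = suc (p + r)
    n = q + s
    later = suc r + s
    p≤n : p ≤ n
    p≤n = ≤-trans (≤-trans (m≤m+n p r) (n≤1+n (p + r))) (m≤m+n q s)
    n≡p'+[1+later] : n ≡ p' + suc later
    n≡p'+[1+later] =
      sym (trans (+-suc p' later) (cong suc (trans (+-suc p' (r + s)) (cong suc (sym (+-assoc p' r s))))))

module Arithmetic where

  open Counting using (interval; interval-++)
  open RowCount using (rowSum)
  open import Data.Nat using (ℕ; zero; suc; _+_; _*_; _∸_; _≤_; _<_; s≤s)
  open import Data.Nat.Properties
    using (+-comm; +-cancelʳ-≡; m∸n+n≡m; n≤1+n; ≤-trans; m≤m+n; m≤n+m; +-monoʳ-<; *-monoʳ-<)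
  open import Data.Nat.Combinatorics using (_C_; nCk+nC[k+1]≡[n+1]C[k+1]; nC1≡n)
  open import Data.Nat.ListAction using (sum)
  open import Data.Nat.ListAction.Properties using (sum-++)
  open import Data.List using (_∷_; []; _++_; map)
  open import Data.List.Properties using (map-++)
  open import Data.Nat.Tactic.RingSolver using (solve-∀)
  open import Relation.Binary.PropositionalEquality
  open ≡-Reasoning

  p'≤n : ∀ p' r s → p' ≤ suc (suc p' + r) + s
  p'≤n p' r s = ≤-trans (n≤1+n p') (≤-trans (m≤m+n (suc p') r) (≤-trans (n≤1+n (suc p' + r)) (m≤m+n _ s)))

  C-succ : ∀ t → suc t C 2 ≡ t + t C 2
  C-succ t = trans (sym (nCk+nC[k+1]≡[n+1]C[k+1] t 1)) (cong (_+ t C 2) (nC1≡n t))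

  C-double : ∀ t → suc t C 2 + suc t C 2 ≡ suc t * t
  C-double zero = refl
  C-double (suc t) =
    begin
      suc (suc t) C 2 + suc (suc t) C 2
    ≡⟨ cong (λ c → c + c) (C-succ (suc t)) ⟩
      (suc t + suc t C 2) + (suc t + suc t C 2)
    ≡⟨ regroup (suc t) (suc t C 2) ⟩
      suc t + suc t + (suc t C 2 + suc t C 2)
    ≡⟨ cong (suc t + suc t +_) (C-double t) ⟩
      suc t + suc t + suc t * t
    ≡⟨ expand t ⟩
      suc (suc t) * suc t
    ∎
    where
    regroup : ∀ a c → (a + c) + (a + c) ≡ a + a + (c + c)
    regroup = solve-∀
    expand : ∀ t → suc t + suc t + suc t * t ≡ suc (suc t) * suc t
    expand = solve-∀

  rowSum-snoc : ∀ n t → rowSum n (suc t) ≡ rowSum n t + ((n ∸ suc t) + 0)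
  rowSum-snoc n t =
    begin
      sum (map (n ∸_) (interval 1 (suc t)))
    ≡⟨ cong (λ l → sum (map (n ∸_) (interval 1 l))) (+-comm 1 t) ⟩
      sum (map (n ∸_) (interval 1 (t + 1)))
    ≡⟨ cong (λ is → sum (map (n ∸_) is)) (interval-++ 1 t 1) ⟩
      sum (map (n ∸_) (interval 1 t ++ suc t ∷ []))
    ≡⟨ cong sum (map-++ (n ∸_) (interval 1 t) _) ⟩
      sum (map (n ∸_) (interval 1 t) ++ (n ∸ suc t) ∷ [])
    ≡⟨ sum-++ (map (n ∸_) (interval 1 t)) _ ⟩
      rowSum n t + ((n ∸ suc t) + 0)
    ∎

  rowSum-closed : ∀ n t → t ≤ n → rowSum n t + suc t C 2 ≡ t * n
  rowSum-closed n zero _ = refl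
  rowSum-closed n (suc t) t<n =
    begin
      rowSum n (suc t) + suc (suc t) C 2
    ≡⟨ cong₂ _+_ (rowSum-snoc n t) (C-succ (suc t)) ⟩
      (rowSum n t + ((n ∸ suc t) + 0)) + (suc t + suc t C 2)
    ≡⟨ regroup (rowSum n t) (n ∸ suc t) (suc t) (suc t C 2) ⟩
      (rowSum n t + suc t C 2) + ((n ∸ suc t) + suc t)
    ≡⟨ cong₂ _+_ (rowSum-closed n t (≤-trans (n≤1+n t) t<n)) (m∸n+n≡m t<n) ⟩
      t * n + n
    ≡⟨ +-comm (t * n) n ⟩
      suc t * n
    ∎
    where
    regroup : ∀ a b c d → (a + (b + 0)) + (c + d) ≡ (a + d) + (b + c)
    regroup = solve-∀

  rank-identity : ∀ p' r s b → let p = suc p' ; q = suc (p + r) ; n = q + s in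
    b ≡ suc (rowSum n p' + r) → b + suc p C 2 ≡ q + p' * n
  rank-identity p' r s b b≡ =
    begin
      b + suc p C 2
    ≡⟨ cong₂ _+_ b≡ (C-succ p) ⟩
      suc (rowSum n p' + r) + (p + p C 2)
    ≡⟨ regroup (rowSum n p') r p (p C 2) ⟩
      suc (p + r) + (rowSum n p' + p C 2)
    ≡⟨ cong (suc (p + r) +_) (rowSum-closed n p' (p'≤n p' r s)) ⟩
      suc (p + r) + p' * n
    ∎
    where
    p n : ℕ
    p = suc p'
    n = suc (p + r) + s
    regroup : ∀ R r p c → suc (R + r) + (p + c) ≡ suc (p + r) + (R + c)
    regroup = solve-∀

  discriminant-identity : ∀ p' r s b → let p = suc p' ; n' = p + r + s ; k = r + s in
    b ≡ suc (rowSum (suc n') p' + r) →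
    4 * suc n' * n' + 1 ≡ ((2 * k + 1) * (2 * k + 1) + 8 * s) + 8 * b
  discriminant-identity p' r s b b≡ = +-cancelʳ-≡ (8 * c) _ _ (
    begin
      4 * n * n' + 1 + 8 * c
    ≡⟨ double (4 * n * n' + 1) c ⟩
      4 * n * n' + 1 + 4 * (c + c)
    ≡⟨ cong (λ x → 4 * n * n' + 1 + 4 * x) (C-double p') ⟩
      4 * n * n' + 1 + 4 * (p * p')
    ≡⟨ expand p' r s ⟩
      D + 8 * suc r + 8 * (p' * n)
    ≡⟨ cong (λ x → D + 8 * suc r + 8 * x) (sym (rowSum-closed n p' (p'≤n p' r s))) ⟩
      D + 8 * suc r + 8 * (rowSum n p' + c)
    ≡⟨ regroup D r (rowSum n p') c ⟩
      D + 8 * suc (rowSum n p' + r) + 8 * c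
    ≡⟨ cong (λ x → D + 8 * x + 8 * c) (sym b≡) ⟩
      D + 8 * b + 8 * c
    ∎)
    where
    p n' n k c D : ℕ
    p = suc p'
    n' = p + r + s
    n = suc n'
    k = r + s
    c = p C 2
    D = (2 * k + 1) * (2 * k + 1) + 8 * s
    double : ∀ x c → x + 8 * c ≡ x + 4 * (c + c)
    double = solve-∀
    expand : ∀ p' r s → let n' = suc p' + r + s in
      4 * suc n' * n' + 1 + 4 * (suc p' * p')
      ≡ (2 * (r + s) + 1) * (2 * (r + s) + 1) + 8 * s + 8 * suc r + 8 * (p' * suc n')
    expand = solve-∀
    regroup : ∀ D r R c → D + 8 * suc r + 8 * (R + c) ≡ D + 8 * suc (R + r) + 8 * c
    regroup = solve-∀

  -- (2k+1)^2 ≤ (2k+1)^2 + 8 s < (2k+3)^2 when s ≤ k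
  discriminant-below : ∀ r s → let k = r + s in
    (2 * k + 1) * (2 * k + 1) + 8 * s < (2 * k + 3) * (2 * k + 3)
  discriminant-below r s =
    subst ((2 * k + 1) * (2 * k + 1) + 8 * s <_) (sym (next-odd-square k))
      (+-monoʳ-< ((2 * k + 1) * (2 * k + 1)) (*-monoʳ-< 8 (s≤s (m≤n+m s r))))
    where
    k : ℕ
    k = r + s
    next-odd-square : ∀ k → (2 * k + 3) * (2 * k + 3) ≡ (2 * k + 1) * (2 * k + 1) + 8 * suc k
    next-odd-square = solve-∀

module FloorHalfSqrt where

  open import Data.Nat using (zero; suc; _+_; _*_; _≤_; _<_; _≤?_; s≤s; z≤n)
  open import Data.Nat.Properties
    using (≤-trans; ≤-<-trans; ≤-antisym; <⇒≱; ≤⇒≯; ≰⇒>; +-comm; +-monoˡ-≤; *-monoʳ-≤; *-mono-≤; m+n≤o⇒n≤o)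
  open import Data.Integer as ℤ using (+_; -[1+_]; 0ℤ)
  open import Data.Integer.Properties using (pos-*; drop‿+≤+; drop‿+<+)
  import Data.Integer.Tactic.RingSolver as ℤ-Solver
  open import Data.Nat.Tactic.RingSolver using (solve-∀)
  open import Data.Product using (_,_)
  open import Data.Sum using (_⊎_; inj₁; inj₂)
  open import Relation.Nullary using (yes; no; contradiction)
  open import Relation.Binary.PropositionalEquality

  odd-square-pos : ∀ k → 1 ≤ (2 * k + 1) * (2 * k + 1)
  odd-square-pos k = subst (λ x → 1 ≤ x * x) (+-comm 1 (2 * k)) (s≤s z≤n)

  odd-step : ∀ {a b} → b < a → 2 * b + 3 ≤ 2 * a + 1
  odd-step {a} {b} b<a = subst (_≤ 2 * a + 1) (next-odd b) (+-monoˡ-≤ 1 (*-monoʳ-≤ 2 b<a))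
    where
    next-odd : ∀ b → 2 * suc b + 1 ≡ 2 * b + 3
    next-odd = solve-∀

  odd-squares-bracket : ∀ {a b D} → (2 * a + 1) * (2 * a + 1) ≤ D → D < (2 * b + 3) * (2 * b + 3) → a ≤ b
  odd-squares-bracket {a} {b} lower upper with a ≤? b
  ... | yes a≤b = a≤b
  ... | no a≰b = contradiction (≤-<-trans lower upper) (≤⇒≯ (*-mono-≤ step step))
    where
    step : 2 * b + 3 ≤ 2 * a + 1
    step = odd-step (≰⇒> a≰b)

  pos-odd : ∀ t c → ℤ.+ 2 ℤ.* + t ℤ.+ + c ≡ + (2 * t + c)
  pos-odd t c = cong (ℤ._+ + c) (sym (pos-* 2 t))

  pos-odd-square : ∀ t c → (ℤ.+ 2 ℤ.* + t ℤ.+ + c) ℤ.* (ℤ.+ 2 ℤ.* + t ℤ.+ + c) ≡ + ((2 * t + c) * (2 * t + c))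
  pos-odd-square t c = trans (cong₂ ℤ._*_ (pos-odd t c) (pos-odd t c)) (sym (pos-* (2 * t + c) (2 * t + c)))

  twice-negative : ∀ t → ℤ.+ 2 ℤ.* -[1+ suc t ] ℤ.+ + 3 ≡ -[1+ 2 * t ]
  twice-negative t = trans (identity (+ t)) (cong (λ x → ℤ.- (+ 1 ℤ.+ x)) (sym (pos-* 2 t)))
    where
    identity : ∀ x → ℤ.+ 2 ℤ.* ℤ.- (+ 2 ℤ.+ x) ℤ.+ + 3 ≡ ℤ.- (+ 1 ℤ.+ ℤ.+ 2 ℤ.* x)
    identity = ℤ-Solver.solve-∀

  nonnegative-lower : ∀ {D t}
    → (ℤ.+ 2 ℤ.* + t ℤ.+ + 1 ℤ.≤ 0ℤ) ⊎ ((ℤ.+ 2 ℤ.* + t ℤ.+ + 1) ℤ.* (ℤ.+ 2 ℤ.* + t ℤ.+ + 1) ℤ.≤ + D)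
    → (2 * t + 1) * (2 * t + 1) ≤ D
  nonnegative-lower {t = t} (inj₁ 2t+1≤0)
    with () ← m+n≤o⇒n≤o (2 * t) (drop‿+≤+ (subst (ℤ._≤ 0ℤ) (pos-odd t 1) 2t+1≤0))
  nonnegative-lower {D} {t} (inj₂ square≤D) = drop‿+≤+ (subst (ℤ._≤ + D) (pos-odd-square t 1) square≤D)

  floorHalfSqrt-unique : ∀ {D k m} → (2 * k + 1) * (2 * k + 1) ≤ D → D < (2 * k + 3) * (2 * k + 3)
    → IsFloorHalfSqrt (+ D) m → m ≡ + k
  floorHalfSqrt-unique {D} {k} {+ t} lower upper (mLower , _ , mUpper) =
    cong +_ (≤-antisym (odd-squares-bracket tLower upper) (odd-squares-bracket lower tUpper))
    where
    tLower : (2 * t + 1) * (2 * t + 1) ≤ D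
    tLower = nonnegative-lower {D} {t} mLower
    tUpper : D < (2 * t + 3) * (2 * t + 3)
    tUpper = drop‿+<+ (subst (+ D ℤ.<_) (pos-odd-square t 3) mUpper)
  floorHalfSqrt-unique {D} {k} {m = -[1+ zero ]} lower upper (_ , _ , D<1) =
    contradiction (≤-trans (odd-square-pos k) lower) (<⇒≱ (drop‿+<+ D<1))
  floorHalfSqrt-unique {m = -[1+ suc t ]} lower upper (_ , 2m+3>0 , _)
    with () ← subst (0ℤ ℤ.<_) (twice-negative t) 2m+3>0

module IntegerForms where

  open import Data.Nat using (ℕ; suc; _+_; _*_)
  open import Data.Integer as ℤ using (+_; _-_)
  open import Data.Integer.Properties using (pos-*)
  open import Data.Integer.Tactic.RingSolver using (solve-∀)
  open import Relation.Binary.PropositionalEquality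
  open ≡-Reasoning

  add-sub-cancel : ∀ x y → x ≡ x ℤ.+ y - y
  add-sub-cancel = solve-∀

  q-formula : ∀ q p' n b c → b + c ≡ q + p' * n → + q ≡ + b ℤ.+ + c - (+ suc p' - + 1) ℤ.* + n
  q-formula q p' n b c b+c≡ =
    begin
      + q
    ≡⟨ add-sub-cancel (+ q) (+ (p' * n)) ⟩
      + (q + p' * n) - + (p' * n)
    ≡⟨ cong₂ (λ x y → + x - y) (sym b+c≡) (pos-* p' n) ⟩
      + (b + c) - + p' ℤ.* + n
    ∎

  discriminant-formula : ∀ n' b D → 4 * suc n' * n' + 1 ≡ D + 8 * b
    → ℤ.+ 4 ℤ.* + suc n' ℤ.* (+ suc n' - + 1) - ℤ.+ 8 ℤ.* + b ℤ.+ + 1 ≡ + D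
  discriminant-formula n' b D disc =
    begin
      ℤ.+ 4 ℤ.* + n ℤ.* + n' - ℤ.+ 8 ℤ.* + b ℤ.+ + 1
    ≡⟨ cong₂ (λ x y → x - y ℤ.+ + 1) (sym pos-4nn') (sym (pos-* 8 b)) ⟩
      + (4 * n * n') - + (8 * b) ℤ.+ + 1
    ≡⟨ move-one (+ (4 * n * n')) (+ (8 * b)) ⟩
      + (4 * n * n' + 1) - + (8 * b)
    ≡⟨ cong (λ x → + x - + (8 * b)) disc ⟩
      + (D + 8 * b) - + (8 * b)
    ≡⟨ sym (add-sub-cancel (+ D) (+ (8 * b))) ⟩
      + D
    ∎
    where
    n : ℕ
    n = suc n'
    pos-4nn' : + (4 * n * n') ≡ ℤ.+ 4 ℤ.* + n ℤ.* + n'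
    pos-4nn' = trans (pos-* (4 * n) n') (cong (ℤ._* + n') (pos-* 4 n))
    move-one : ∀ x y → x - y ℤ.+ + 1 ≡ x ℤ.+ + 1 - y
    move-one = solve-∀


open import Data.Nat using (ℕ; suc; _≤_; _<_)
import Data.Nat as ℕ
open import Data.Nat.Properties using (m≤n⇒∃[o]m+o≡n; m≤m+n; +-assoc)
open import Data.Nat.Combinatorics using (_C_)
open import Data.Integer as ℤ using (ℤ; +_; _-_; _*_)
open import Data.Product using (_×_; _,_)
open import Relation.Binary.PropositionalEquality using (_≡_; refl; sym; trans; cong; cong₂; subst; module ≡-Reasoning)
open RowCount using (rowSum; numLarger-formula)
open Arithmetic using (rank-identity; discriminant-identity; discriminant-below)
open FloorHalfSqrt using (floorHalfSqrt-unique)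
open IntegerForms using (add-sub-cancel; q-formula; discriminant-formula)

lemma5p3 : (n b p q : ℕ) → 1 ≤ n → 1 ≤ b → b < n C 2
    → 1 ≤ p → p < q → q ≤ n
    → suc (numLarger n p q) ≡ b
    → (m : ℤ)
    → IsFloorHalfSqrt (+ 4 ℤ.* + n ℤ.* (+ n - + 1) - + 8 ℤ.* + b ℤ.+ + 1) m
    → (+ p ≡ + n - + 1 - m)
      × (+ q ≡ + b ℤ.+ + (suc p C 2) - (+ p - + 1) ℤ.* + n)
lemma5p3 n b (suc p') q _ _ _ _ p<q q≤n rank≡b m floor
  with r , refl ← m≤n⇒∃[o]m+o≡n p<q | s , refl ← m≤n⇒∃[o]m+o≡n q≤n =
  p-formula , q-formula q p' n b (suc (suc p') C 2) (rank-identity p' r s b b≡)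
  where
  open ≡-Reasoning
  -- n - 1
  n' : ℕ
  n' = suc p' ℕ.+ r ℕ.+ s
  b≡ : b ≡ suc (rowSum (suc (suc p' ℕ.+ r) ℕ.+ s) p' ℕ.+ r)
  b≡ = trans (sym rank≡b) (cong suc (numLarger-formula p' r s))
  -- the discriminant lies in [(2k+1)^2, (2k+3)^2) for k = r + s, so the floor is k
  m≡k : m ≡ + (r ℕ.+ s)
  m≡k = floorHalfSqrt-unique (m≤m+n _ _) (discriminant-below r s)
    (subst (λ D → IsFloorHalfSqrt D m) (discriminant-formula n' b _ (discriminant-identity p' r s b b≡)) floor)
  p-formula : + suc p' ≡ + n' - m
  p-formula =
    begin
      + suc p'
    ≡⟨ add-sub-cancel (+ suc p') (+ (r ℕ.+ s)) ⟩
      + (suc p' ℕ.+ (r ℕ.+ s)) - + (r ℕ.+ s)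
    ≡⟨ cong₂ (λ x y → + x - y) (sym (+-assoc (suc p') r s)) (sym m≡k) ⟩
      + n' - m
    ∎
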